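{- Let $m,p,r$ be positive integers with $p\mid m$ and $n=2r+1$. For every $P\in\mathrm{APS}(m,1,n)\setminus\mathrm{APS}(m,p,n)$ there exists $P'\in\mathrm{APS}(p,1,n)\setminus\mathrm{APS}(p,p,n)$ with $P=\Psi_{m-p}(P')$.
   Context: For a positive integer $M$ let $\eta_M=e^{2\pi i/M}$; for $0\le a\le M-1$ and $x\in[n]=\{1,\dots,n\}$, $\eta_M^a(x)$ denotes $\eta_M^a\cdot x$, and $\mathbb{I}_n^M=\bigcup_{a=0}^{M-1}\{\eta_M^a(1),\dots,\eta_M^a(n)\}$, totally ordered by $\eta_M^a(x)\prec\eta_M^b(y)$ iff $a>b$, or $a=b$ and $x>y$. $\mathbb{Z}_M\wr S_n$ is the group of bijections $w$ of $\mathbb{I}_n^M$ with $w(\eta_M^i x)=\eta_M^i w(x)$ for $x\in[n]$, all $i$, written $w(n)\cdots w(1)$. $\operatorname{Pin}(w)=\{w(i):2\le i\le n-1,\ w(i+1)\prec w(i)\succ w(i-1)\}$. For $w$ with $w(i)=\eta_M^{e_i}(x_i)$, $e_i\in\{0,\dots,M-1\}$, $\varepsilon_w=\sum_i e_i$. For $q\mid M$, $G(M,q,n)=\{w\in\mathbb{Z}_M\wr S_n:\varepsilon_w\equiv0\pmod q\}$, and $\mathrm{APS}(M,q,n)$ is the set of all $P\subseteq\mathbb{I}_n^M$ with $P=\operatorname{Pin}(w)$ for some $w\in G(M,q,n)$. The map $\Psi_{m-p}$ sends a subset $\{\eta_p^{a_j}(x_j)\}$ of $\mathbb{I}_n^p$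 to the subset $\{\eta_m^{a_j+m-p}(x_j)\}$ of $\mathbb{I}_n^m$. -}

module Defs where

open import Data.Nat using (ℕ; zero; suc; _+_; _*_; _∸_; _≤_; _<_; NonZero)
open import Data.Nat.Properties using (+-monoˡ-<; m+[n∸m]≡n)
open import Data.Nat.Divisibility using (_∣_; ∣⇒≤)
open import Data.Fin using (Fin; toℕ; fromℕ<)
open import Data.Fin.Properties using (toℕ<n)
open import Data.Fin.Permutation using (Permutation′; _⟨$⟩ʳ_)
open import Data.List using (map; allFin)
open import Data.Nat.ListAction using (sum)
open import Data.Product using (Σ; ∃; _×_; _,_; proj₁; proj₂)
open import Data.Sum using (_⊎_)
open import Function.Bundles using (_⇔_)
open import Relation.Binary.PropositionalEquality using (_≡_; subst)

-- η_M^a(x) with a ∈ {0..M-1}, x ∈ [n]; represented as (a , x) with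
-- a : Fin M and x : Fin n (x encodes the integer toℕ x + 1).
Elt : ℕ → ℕ → Set
Elt M n = Fin M × Fin n

_≺_ : ∀ {M n} → Elt M n → Elt M n → Set
(a , x) ≺ (b , y) = (toℕ b < toℕ a) ⊎ ((toℕ a ≡ toℕ b) × (toℕ y < toℕ x))

-- An element of Z_M ≀ S_n, determined by its values w(1),...,w(n):
-- w(i) = η_M^{col i}(σ i); position i ∈ [n] is encoded by i : Fin n.
record ColPerm (M n : ℕ) : Set where
  field
    σ   : Permutation′ n
    col : Fin n → Fin M

open ColPerm public

apply : ∀ {M n} → ColPerm M n → Fin n → Elt M n
apply w i = col w i , σ w ⟨$⟩ʳ i

ε : ∀ {M n} → ColPerm M n → ℕ
ε {n = n} w = sum (map (λ i → toℕ (col w i)) (allFin n))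

Subset : ℕ → ℕ → Set₁
Subset M n = Elt M n → Set

-- Pin(w) = { w(j) : 2 ≤ j ≤ n-1, w(j+1) ≺ w(j) ≻ w(j-1) }
-- (i, j, k are consecutive positions j-1, j, j+1)
Pin : ∀ {M n} → ColPerm M n → Subset M n
Pin {n = n} w e =
  Σ (Fin n) λ i → Σ (Fin n) λ j → Σ (Fin n) λ k →
    (toℕ j ≡ suc (toℕ i)) × (toℕ k ≡ suc (toℕ j)) ×
    (apply w j ≡ e) × (apply w k ≺ apply w j) × (apply w i ≺ apply w j)

_≐_ : ∀ {M n} → Subset M n → Subset M n → Set
P ≐ Q = ∀ e → P e ⇔ Q e

-- P ∈ APS(M,q,n): P = Pin(w) for some w ∈ G(M,q,n)
APS : (M q n : ℕ) → Subset M n → Set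
APS M q n P = Σ (ColPerm M n) λ w → (q ∣ ε w) × (P ≐ Pin w)

ψ : (m p : ℕ) {n : ℕ} → p ≤ m → Elt p n → Elt m n
ψ m p p≤m (a , x) =
  fromℕ< {toℕ a + (m ∸ p)}
    (subst (toℕ a + (m ∸ p) <_) (m+[n∸m]≡n p≤m) (+-monoˡ-< (m ∸ p) (toℕ<n a)))
  , x

Ψ : (m p : ℕ) {n : ℕ} → p ≤ m → Subset p n → Subset m n
Ψ m p p≤m P' e = Σ (Elt p _) λ e' → P' e' × (ψ m p p≤m e' ≡ e)

∣⇒≤' : (m p : ℕ) → .{{_ : NonZero m}} → p ∣ m → p ≤ m
∣⇒≤' m p d = ∣⇒≤ d

-- Let P = Pin w.  If every colour of w is at least m − p, lowering all colours by m − p gives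
-- w′ ∈ ℤ_p ≀ S_n with P = Ψ_{m−p}(Pin w′); raising them back adds n(m − p), a multiple of p,
-- to ε, so Pin w′ ∈ APS(p,p,n) would put P in APS(m,p,n).
--
-- Otherwise some colour is below m − p, so m ≥ 2p, and we show P ∈ APS(m,p,n), against the
-- hypothesis (this needs only n ≥ 2, not that n is odd).  Read w as the word w(1) … w(n) and let
-- T be its largest letter, whose colour is then below m − p.  We rearrange the word, keeping its
-- pinnacle set, so that an end letter can take any colour from a window of p consecutive colours
-- without changing a comparison that matters; one colour in the window makes ε divisible by p.
-- If T is interior, the two sides of T are merged into y T X, and y may take any colour ≥ m − p.
-- If T is at an end, the least letter h is brought next to it, T h …, and T may take any colour
-- < p when h has colour ≥ p; otherwise every colour is < p, and in h … T the letter h may take any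
-- colour ≥ m − p.
--
-- The rearrangements are built by recursion on the decreasing binary tree of the word: if M
-- exceeds every letter of X and of Y, then Pin(X M Y) = Pin X ∪ Pin Y ∪ {M | X, Y nonempty}.

module Submission where

open import Defs hiding (_≐_)
open import Data.Nat using (ℕ; _+_; _*_; NonZero)
open import Data.Nat.Divisibility using (_∣_)
open import Data.Product using (Σ; _×_)
open import Relation.Nullary using (¬_)

open import Data.Empty using (⊥; ⊥-elim)
open import Data.Fin using (Fin; zero; suc; toℕ; fromℕ<; cast)
open import Data.Fin.Permutation using (permutation; _⟨$⟩ʳ_; _⟨$⟩ˡ_; inverseʳ)
open import Data.Fin.Properties using (toℕ<n; toℕ-fromℕ<; toℕ-injective; cast-involutive; cast-is-id; any?)
open import Data.List using (List; []; _∷_; _++_; _∷ʳ_; length; map; lookup; tabulate; allFin)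
open import Data.List.Membership.Propositional using (_∈_)
open import Data.List.Membership.Propositional.Properties using (∈-++⁺ˡ; ∈-++⁺ʳ; ∈-lookup)
open import Data.List.Properties
  using (++-assoc; ++-identityʳ; length-tabulate; map-tabulate; map-cong; tabulate-cong; tabulate-lookup)
open import Data.List.Relation.Binary.Disjoint.Propositional using (Disjoint)
import Data.List.Relation.Binary.Disjoint.Propositional.Properties as Disjoint
open import Data.List.Relation.Binary.Permutation.Propositional
  using (_↭_; ↭-refl; ↭-sym; ↭-trans; ↭-reflexive; prep; swap; ↭⇒↭ₛ)
open import Data.List.Relation.Binary.Permutation.Propositional.Properties
  using (All-resp-↭; ++⁺ʳ; shift; ++-comm; ∷↭∷ʳ; ↭-length)
import Data.List.Relation.Binary.Permutation.Propositional.Properties as Permutation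
import Data.List.Relation.Binary.Permutation.Setoid.Properties as PermutationSetoid
open import Data.List.Relation.Unary.All as All using (All; []; _∷_)
import Data.List.Relation.Unary.All.Properties as All
open import Data.List.Relation.Unary.AllPairs using (AllPairs; []; _∷_)
import Data.List.Relation.Unary.AllPairs.Properties as AllPairs
open import Data.List.Relation.Unary.Any as Any using (Any; here; there)
import Data.List.Relation.Unary.Any.Properties as Any
open import Data.List.Relation.Unary.Unique.Propositional using (Unique)
import Data.List.Relation.Unary.Unique.Propositional.Properties as Unique
open import Data.Nat using (suc; _∸_; _≤_; _<_; s≤s; z≤n; _<?_; >-nonZero)
open import Data.Nat.Divisibility using (divides; ∣⇒≤; 1∣_; ∣-refl; ∣m∣n⇒∣m+n; ∣n⇒∣m*n; ∣m+n∣m⇒∣n)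
open import Data.Nat.DivMod using (_%_; _/_; m≡m%n+[m/n]*n; m%n<n)
open import Data.Nat.ListAction using (sum)
import Data.Nat.Properties as ℕ
open import Algebra.Properties.CommutativeSemigroup ℕ.+-commutativeSemigroup using (interchange)
open import Data.Nat.Properties
  using (≤-pred; suc-injective; <⇒≤; ≤-refl; ≤-reflexive; ≤-trans; <-≤-trans; ≤-<-trans; ≮⇒≥;
         m∸n≤m; m≤m+n; m≤n+m; +-monoʳ-<; +-monoˡ-<; +-cancelʳ-<; +-cancelʳ-≡; +-assoc; +-comm;
         +-∸-assoc; m+n∸m≡n; m∸n+n≡m; m+[n∸m]≡n; m∸[m∸n]≡n; ∸-monoˡ-<)
open import Data.Product using (∃; _,_; proj₁; proj₂)
import Data.Product as Prod
open import Data.Sum using (_⊎_; inj₁; inj₂; [_,_]; [_,_]′)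
import Data.Sum as Sum
open import Data.Unit using (⊤; tt)
open import Function using (id; _∘_; _on_)
open import Function.Bundles using (mk⇔; Equivalence; Injection)
open import Function.Properties.Inverse using (Inverse⇒Injection)
open import Level using (0ℓ)
open import Relation.Binary
  using (Rel; Transitive; Irreflexive; Trichotomous; IsStrictTotalOrder; StrictTotalOrder; Tri; tri<; tri≈; tri>)
open import Relation.Binary.PropositionalEquality
  using (_≡_; _≢_; _≗_; refl; sym; trans; cong; cong₂; subst; subst₂; isEquivalence; resp₂; setoid;
         module ≡-Reasoning)
open import Relation.Nullary using (yes; no)

Unique-resp-↭ : ∀ {A : Set} {xs ys : List A} → xs ↭ ys → Unique xs → Unique ys
Unique-resp-↭ = PermutationSetoid.Unique-resp-↭ (setoid _) ∘ ↭⇒↭ₛ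

Unique-++⇒Disjoint : ∀ {A : Set} (xs : List A) {ys} → Unique (xs ++ ys) → Disjoint xs ys
Unique-++⇒Disjoint (x ∷ xs) (x∉ ∷ _) (here refl , x∈ys)  = All.lookup (All.++⁻ʳ xs x∉) x∈ys refl
Unique-++⇒Disjoint (x ∷ xs) (_ ∷ u)  (there v∈xs , v∈ys) = Unique-++⇒Disjoint xs u (v∈xs , v∈ys)

tabulate-lookup-cast : ∀ {A : Set} {n} (xs : List A) (|xs|≡n : length xs ≡ n) →
                       tabulate (lookup xs ∘ cast (sym |xs|≡n)) ≡ xs
tabulate-lookup-cast xs refl =
  trans (tabulate-cong (cong (lookup xs) ∘ cast-is-id refl)) (tabulate-lookup xs)

sum-map-+ : ∀ {A : Set} (f : A → ℕ) c xs →
            sum (map (λ x → f x + c) xs) ≡ sum (map f xs) + length xs * c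
sum-map-+ f c []       = refl
sum-map-+ f c (x ∷ xs) = trans (cong (f x + c +_) (sum-map-+ f c xs)) (interchange (f x) c _ _)

∣m∣n⇒∣m∸n : ∀ {d m n} → n ≤ m → d ∣ m → d ∣ n → d ∣ m ∸ n
∣m∣n⇒∣m∸n n≤m d∣m d∣n = ∣m+n∣m⇒∣n (subst (_ ∣_) (sym (m+[n∸m]≡n n≤m)) d∣m) d∣n

2≤2r+1 : ∀ r → NonZero r → 2 ≤ 2 * r + 1
2≤2r+1 (suc r) _ = s≤s (m≤n+m 1 _)

∃-offset-to-multiple : ∀ p N .{{_ : NonZero p}} → ∃ λ t → t < p × p ∣ N + t
∃-offset-to-multiple (suc p) N = p ∸ r , s≤s (m∸n≤m p r) , divides q N+t≡q*p
  where
  open ≡-Reasoning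
  r = (N + p) % suc p
  q = (N + p) / suc p
  N+t≡q*p : N + (p ∸ r) ≡ q * suc p
  N+t≡q*p = begin
    N + (p ∸ r)       ≡⟨ +-∸-assoc N (≤-pred (m%n<n (N + p) (suc p))) ⟨
    N + p ∸ r         ≡⟨ cong (_∸ r) (m≡m%n+[m/n]*n (N + p) (suc p)) ⟩
    r + q * suc p ∸ r ≡⟨ m+n∸m≡n r (q * suc p) ⟩
    q * suc p         ∎

∃-colour-in-window : ∀ {m} p .{{_ : NonZero p}} S lo → lo + p ≤ m →
                     ∃ λ (d : Fin m) → lo ≤ toℕ d × toℕ d < lo + p × p ∣ toℕ d + S
∃-colour-in-window p S lo lo+p≤m with ∃-offset-to-multiple p (S + lo)
... | t , t<p , p∣S+lo+t =
  d , subst (lo ≤_) (sym d≡lo+t) (m≤m+n lo t) , subst (_< lo + p) (sym d≡lo+t) (+-monoʳ-< lo t<p) ,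
  subst (p ∣_) (trans (+-assoc S lo t) (trans (+-comm S (lo + t)) (cong (_+ S) (sym d≡lo+t)))) p∣S+lo+t
  where
  d = fromℕ< (<-≤-trans (+-monoʳ-< lo t<p) lo+p≤m)
  d≡lo+t : toℕ d ≡ lo + t
  d≡lo+t = toℕ-fromℕ< _

module Pinnacles {E : Set} {_<_ : Rel E 0ℓ} (sto : IsStrictTotalOrder _≡_ _<_) where

  open import Relation.Unary using (Pred; _⊆_; _≐_; _∪_)
  open import Relation.Unary.Algebra using (∪-cong; ∪-comm; ∪-assoc)
  open import Relation.Unary.Properties using (≐-refl; ≐-sym; ≐-trans)
  open import Relation.Unary.Relation.Binary.Equality using (≐-setoid)
  open import Relation.Binary.Reasoning.Setoid (≐-setoid E 0ℓ)

  open IsStrictTotalOrder sto using (asym; compare) renaming (trans to <-trans)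

  private
    strictTotalOrder : StrictTotalOrder 0ℓ 0ℓ 0ℓ
    strictTotalOrder = record { isStrictTotalOrder = sto }

  open import Relation.Binary.Construct.StrictToNonStrict _≡_ _<_ public
    using () renaming (_≤_ to _≼_)
  open import Relation.Binary.Properties.StrictTotalOrder strictTotalOrder
    using () renaming (trans to ≼-trans)

  trichotomy : ∀ x y → x < y ⊎ x ≡ y ⊎ y < x
  trichotomy x y with compare x y
  ... | tri< x<y _ _ = inj₁ x<y
  ... | tri≈ _ x≡y _ = inj₂ (inj₁ x≡y)
  ... | tri> _ _ y<x = inj₂ (inj₂ y<x)

  Pinnacle : List E → Pred E 0ℓ
  Pinnacle (a ∷ b ∷ c ∷ xs) e = (b ≡ e × a < b × c < b) ⊎ Pinnacle (b ∷ c ∷ xs) e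
  Pinnacle _                e = ⊥

  Pinnacle-cong : ∀ {xs ys} → xs ≡ ys → Pinnacle xs ≐ Pinnacle ys
  Pinnacle-cong refl = ≐-refl

  pinnacle-∷⁺ : ∀ {a} xs → Pinnacle xs ⊆ Pinnacle (a ∷ xs)
  pinnacle-∷⁺ (_ ∷ _ ∷ _ ∷ _) = inj₂

  pinnacle-∷-descent : ∀ {a b} xs → b < a → Pinnacle (a ∷ b ∷ xs) ≐ Pinnacle (b ∷ xs)
  pinnacle-∷-descent []      _   = (λ ()) , (λ ())
  pinnacle-∷-descent (_ ∷ _) b<a = [ (λ (_ , a<b , _) → ⊥-elim (asym b<a a<b)) , id ] , inj₂

  pinnacle-∷-ascent : ∀ {a b c} xs → b < c → Pinnacle (a ∷ b ∷ c ∷ xs) ≐ Pinnacle (b ∷ c ∷ xs)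
  pinnacle-∷-ascent _ b<c = [ (λ (_ , _ , c<b) → ⊥-elim (asym b<c c<b)) , id ] , inj₂

  pinnacle-head-below : ∀ {a a′ b} xs → a < b → a′ < b →
                        Pinnacle (a ∷ b ∷ xs) ≐ Pinnacle (a′ ∷ b ∷ xs)
  pinnacle-head-below []      _   _    = (λ ()) , (λ ())
  pinnacle-head-below (_ ∷ _) a<b a′<b =
    Sum.map₁ (Prod.map₂ (Prod.map₁ (λ _ → a′<b))) , Sum.map₁ (Prod.map₂ (Prod.map₁ (λ _ → a<b)))

  -- For a coloured permutation w, Defs.Pin w is IndexPinnacle (apply w) by definition.
  IndexPinnacle : ∀ {k} → (Fin k → E) → Pred E 0ℓ
  IndexPinnacle {k} f e = Σ (Fin k) λ i → Σ (Fin k) λ j → Σ (Fin k) λ l →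
    (toℕ j ≡ suc (toℕ i)) × (toℕ l ≡ suc (toℕ j)) × (f j ≡ e) × (f l < f j) × (f i < f j)

  pinnacle-tabulate : ∀ {k} (f : Fin k → E) → IndexPinnacle f ≐ Pinnacle (tabulate f)
  pinnacle-tabulate f = (λ (i , j , l , j≡1+i , l≡1+j , p) → to f i j l j≡1+i l≡1+j p) , from f
    where
    to : ∀ {k} (f : Fin k → E) {e} i j l → toℕ j ≡ suc (toℕ i) → toℕ l ≡ suc (toℕ j) →
         f j ≡ e × f l < f j × f i < f j → Pinnacle (tabulate f) e
    to f zero    (suc zero)    (suc (suc zero))    refl  refl  (fj≡e , fl<fj , fi<fj) =
      inj₁ (fj≡e , fi<fj , fl<fj)
    to f (suc i) (suc j)       (suc l)             j≡1+i l≡1+j p =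
      pinnacle-∷⁺ _ (to (f ∘ suc) i j l (suc-injective j≡1+i) (suc-injective l≡1+j) p)
    to f zero    zero          _                   ()
    to f zero    (suc (suc _)) _                   ()
    to f zero    (suc zero)    zero                _     ()
    to f zero    (suc zero)    (suc zero)          _     ()
    to f zero    (suc zero)    (suc (suc (suc _))) _     ()
    to f (suc _) zero          _                   ()
    to f (suc _) (suc _)       zero                _     ()
    from : ∀ {k} (f : Fin k → E) → Pinnacle (tabulate f) ⊆ IndexPinnacle f
    from {suc (suc (suc _))} f (inj₁ (fj≡e , fi<fj , fl<fj)) =
      zero , suc zero , suc (suc zero) , refl , refl , fj≡e , fl<fj , fi<fj
    from {suc (suc (suc _))} f (inj₂ p) with from (f ∘ suc) p
    ... | i , j , l , j≡1+i , l≡1+j , q = suc i , suc j , suc l , cong suc j≡1+i , cong suc l≡1+j , q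

  IndexPinnacle-cong : ∀ {k} {f g : Fin k → E} → f ≗ g → IndexPinnacle f ≐ IndexPinnacle g
  IndexPinnacle-cong {f = f} {g} f≗g = begin
    IndexPinnacle f       ≈⟨ pinnacle-tabulate f ⟩
    Pinnacle (tabulate f) ≈⟨ Pinnacle-cong (tabulate-cong f≗g) ⟩
    Pinnacle (tabulate g) ≈⟨ pinnacle-tabulate g ⟨
    IndexPinnacle g       ∎

  NonEmpty : List E → Set
  NonEmpty []      = ⊥
  NonEmpty (_ ∷ _) = ⊤

  NonEmpty-++⁺ˡ : ∀ {X} Y → NonEmpty X → NonEmpty (X ++ Y)
  NonEmpty-++⁺ˡ {_ ∷ _} _ _ = tt

  NonEmpty-++⁺ʳ : ∀ X {Y} → NonEmpty Y → NonEmpty (X ++ Y)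
  NonEmpty-++⁺ʳ []      neY = neY
  NonEmpty-++⁺ʳ (_ ∷ _) _   = tt

  NonEmpty-resp-↭ : ∀ {X Y} → X ↭ Y → NonEmpty X → NonEmpty Y
  NonEmpty-resp-↭ {_ ∷ _} {[]}    X↭[] _ with () ← ↭-length X↭[]
  NonEmpty-resp-↭ {_}     {_ ∷ _} _    _ = tt

  Peak : List E → E → List E → Pred E 0ℓ
  Peak X M Y e = M ≡ e × NonEmpty X × NonEmpty Y

  Peak-congˡ : ∀ {X X′ M Y} → NonEmpty X → NonEmpty X′ → Peak X M Y ≐ Peak X′ M Y
  Peak-congˡ ne ne′ = Prod.map₂ (Prod.map₁ (λ _ → ne′)) , Prod.map₂ (Prod.map₁ (λ _ → ne))

  pinnacle-max∷ : ∀ {M} Y → All (_< M) Y → Pinnacle (M ∷ Y) ≐ Pinnacle Y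
  pinnacle-max∷ []       _         = (λ ()) , (λ ())
  pinnacle-max∷ (_ ∷ ys) (b<M ∷ _) = pinnacle-∷-descent ys b<M

  pinnacle-++-max : ∀ X {M} Y → All (_< M) X → All (_< M) Y →
                    Pinnacle (X ++ M ∷ Y) ≐ Pinnacle X ∪ Pinnacle Y ∪ Peak X M Y
  pinnacle-++-max [] Y _ Y<M =
    inj₂ ∘ inj₁ ∘ proj₁ (pinnacle-max∷ Y Y<M) ,
    [ (λ ()) , [ proj₂ (pinnacle-max∷ Y Y<M) , ⊥-elim ∘ proj₁ ∘ proj₂ ] ]
  pinnacle-++-max (a ∷ []) [] _ _ =
    (λ ()) , [ (λ ()) , [ (λ ()) , ⊥-elim ∘ proj₂ ∘ proj₂ ] ]
  pinnacle-++-max (a ∷ []) Y@(b ∷ _) (a<M ∷ []) Y<M@(b<M ∷ _) =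
    [ (λ (M≡e , _) → inj₂ (inj₂ (M≡e , tt , tt))) , inj₂ ∘ inj₁ ∘ proj₁ (pinnacle-max∷ Y Y<M) ] ,
    [ (λ ()) , [ inj₂ ∘ proj₂ (pinnacle-max∷ Y Y<M) , (λ (M≡e , _) → inj₁ (M≡e , a<M , b<M)) ] ]
  pinnacle-++-max (a ∷ a′ ∷ []) Y (_ ∷ X<M@(a′<M ∷ [])) Y<M =
    ≐-trans (pinnacle-∷-ascent Y a′<M) (pinnacle-++-max (a′ ∷ []) Y X<M Y<M)
  pinnacle-++-max (a ∷ a′ ∷ c ∷ X) Y (_ ∷ X<M) Y<M =
    ≐-trans (∪-cong ≐-refl (pinnacle-++-max (a′ ∷ c ∷ X) Y X<M Y<M)) (≐-sym (∪-assoc _ _ _))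

  pinnacle-∷ʳ-max : ∀ X {M} → All (_< M) X → Pinnacle (X ∷ʳ M) ≐ Pinnacle X
  pinnacle-∷ʳ-max X X<M =
    ≐-trans (pinnacle-++-max X [] X<M []) ([ id , [ (λ ()) , ⊥-elim ∘ proj₂ ∘ proj₂ ] ] , inj₁)

  pinnacle-swap-max : ∀ X {M} Y → All (_< M) X → All (_< M) Y →
                      Pinnacle (Y ++ M ∷ X) ≐ Pinnacle (X ++ M ∷ Y)
  pinnacle-swap-max X {M} Y X<M Y<M = begin
    Pinnacle (Y ++ M ∷ X)                ≈⟨ pinnacle-++-max Y X Y<M X<M ⟩
    Pinnacle Y ∪ Pinnacle X ∪ Peak Y M X ≈⟨ exchange , exchange ⟩
    Pinnacle X ∪ Pinnacle Y ∪ Peak X M Y ≈⟨ pinnacle-++-max X Y X<M Y<M ⟨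
    Pinnacle (X ++ M ∷ Y)                ∎
    where
    exchange : ∀ {X Y} → Pinnacle Y ∪ Pinnacle X ∪ Peak Y M X ⊆ Pinnacle X ∪ Pinnacle Y ∪ Peak X M Y
    exchange = [ inj₂ ∘ inj₁ , [ inj₁ , inj₂ ∘ inj₂ ∘ Prod.map₂ Prod.swap ] ]

  pinnacle-++-max-∪ : ∀ {Q X C M} Y → NonEmpty X → NonEmpty C →
                      All (_< M) X → All (_< M) C → All (_< M) Y →
                      Pinnacle X ≐ Q ∪ Pinnacle C → Pinnacle (X ++ M ∷ Y) ≐ Q ∪ Pinnacle (C ++ M ∷ Y)
  pinnacle-++-max-∪ {Q} {X} {C} {M} Y neX neC X<M C<M Y<M X≐Q∪C = begin
    Pinnacle (X ++ M ∷ Y)                      ≈⟨ pinnacle-++-max X Y X<M Y<M ⟩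
    Pinnacle X ∪ Pinnacle Y ∪ Peak X M Y       ≈⟨ ∪-cong X≐Q∪C (∪-cong ≐-refl (Peak-congˡ neX neC)) ⟩
    (Q ∪ Pinnacle C) ∪ Pinnacle Y ∪ Peak C M Y ≈⟨ ∪-assoc _ _ _ ⟩
    Q ∪ Pinnacle C ∪ Pinnacle Y ∪ Peak C M Y   ≈⟨ ∪-cong ≐-refl (pinnacle-++-max C Y C<M Y<M) ⟨
    Q ∪ Pinnacle (C ++ M ∷ Y)                  ∎

  data MaxTree : List E → Set where
    leaf : MaxTree []
    node : ∀ {L M R} → MaxTree L → All (_< M) L → All (_< M) R → MaxTree R → MaxTree (L ++ M ∷ R)

  ++-∷-below : ∀ L {M R z} → All (_< M) L → All (_< M) R → M < z → All (_< z) (L ++ M ∷ R)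
  ++-∷-below L L<M R<M M<z =
    All.++⁺ (All.map (λ x<M → <-trans x<M M<z) L<M) (M<z ∷ All.map (λ x<M → <-trans x<M M<z) R<M)

  ∷-maxTree : ∀ {z Z} → MaxTree Z → All (z ≢_) Z → MaxTree (z ∷ Z)
  ∷-maxTree leaf _ = node leaf [] [] leaf
  ∷-maxTree {z} (node {L} {M} tL L<M R<M tR) z∉ with compare z M
  ... | tri< z<M _ _ = node (∷-maxTree tL (All.++⁻ˡ L z∉)) (z<M ∷ L<M) R<M tR
  ... | tri≈ _ z≡M _ = ⊥-elim (All.head (All.++⁻ʳ L z∉) z≡M)
  ... | tri> _ _ M<z = node leaf [] (++-∷-below L L<M R<M M<z) (node tL L<M R<M tR)

  maxTree : ∀ {Z} → Unique Z → MaxTree Z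
  maxTree []          = leaf
  maxTree (z∉ ∷ uniq) = ∷-maxTree (maxTree uniq) z∉

  max∈ : ∀ L {M : E} {R} → M ∈ L ++ M ∷ R
  max∈ L = ∈-++⁺ʳ L (here refl)

  record MinFirst (Z : List E) : Set where
    constructor mkMinFirst
    field
      least        : E
      others       : List E
      ↭Z           : least ∷ others ↭ Z
      pinnacles    : Pinnacle (least ∷ others) ≐ Pinnacle Z
      least≼others : All (least ≼_) others

  open MinFirst using (least)

  least≼-all : ∀ {Z x} (m : MinFirst Z) → x ≼ least m → All (x ≼_) Z
  least≼-all (mkMinFirst _ _ ↭Z _ least≼others) x≼least =
    All-resp-↭ ↭Z (x≼least ∷ All.map (≼-trans x≼least) least≼others)

  minFirst-++-max : ∀ {X M Y} (m : MinFirst X) → NonEmpty X → All (_< M) X → All (_< M) Y →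
                    All (least m ≼_) Y → MinFirst (X ++ M ∷ Y)
  minFirst-++-max {X} {M} {Y} (mkMinFirst h t ↭X pins h≼t) neX X<M Y<M h≼Y =
    mkMinFirst h (t ++ M ∷ Y) (++⁺ʳ (M ∷ Y) ↭X) (begin
      Pinnacle (h ∷ t ++ M ∷ Y)
        ≈⟨ pinnacle-++-max (h ∷ t) Y ht<M Y<M ⟩
      Pinnacle (h ∷ t) ∪ Pinnacle Y ∪ Peak (h ∷ t) M Y
        ≈⟨ ∪-cong pins (∪-cong ≐-refl (Peak-congˡ {h ∷ t} tt neX)) ⟩
      Pinnacle X ∪ Pinnacle Y ∪ Peak X M Y
        ≈⟨ pinnacle-++-max X Y X<M Y<M ⟨
      Pinnacle (X ++ M ∷ Y)
        ∎)
      (All.++⁺ h≼t (inj₁ (All.head ht<M) ∷ h≼Y))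
    where
    ht<M : All (_< M) (h ∷ t)
    ht<M = All-resp-↭ (↭-sym ↭X) X<M

  minFirst-swap : ∀ {X M Y} → All (_< M) X → All (_< M) Y → MinFirst (Y ++ M ∷ X) → MinFirst (X ++ M ∷ Y)
  minFirst-swap {X} {M} {Y} X<M Y<M (mkMinFirst h t ↭YX pins h≼t) =
    mkMinFirst h t (↭-trans ↭YX (↭-trans (++-comm Y (M ∷ X)) (↭-sym (shift M X Y))))
                   (≐-trans pins (pinnacle-swap-max X Y X<M Y<M)) h≼t

  minFirst : ∀ {L M R} → MaxTree L → All (_< M) L → All (_< M) R → MaxTree R → MinFirst (L ++ M ∷ R)
  minFirst {M = M} leaf _ _ leaf = mkMinFirst M [] ↭-refl ≐-refl []
  minFirst (node t₁ l₁ r₁ t₂) L<M R<M leaf =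
    minFirst-++-max (minFirst t₁ l₁ r₁ t₂) (NonEmpty-++⁺ʳ _ tt) L<M [] []
  minFirst leaf L<M R<M (node t₁ l₁ r₁ t₂) =
    minFirst-swap L<M R<M (minFirst-++-max (minFirst t₁ l₁ r₁ t₂) (NonEmpty-++⁺ʳ _ tt) R<M [] [])
  minFirst (node t₁ l₁ r₁ t₂) L<M R<M (node t₃ l₃ r₃ t₄)
    with minFirst t₁ l₁ r₁ t₂ | minFirst t₃ l₃ r₃ t₄
  ... | mL | mR with compare (least mL) (least mR)
  ... | tri< lt _ _ = minFirst-++-max mL (NonEmpty-++⁺ʳ _ tt) L<M R<M (least≼-all mR (inj₁ lt))
  ... | tri≈ _ eq _ = minFirst-++-max mL (NonEmpty-++⁺ʳ _ tt) L<M R<M (least≼-all mR (inj₂ eq))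
  ... | tri> _ _ gt =
    minFirst-swap L<M R<M (minFirst-++-max mR (NonEmpty-++⁺ʳ _ tt) R<M L<M (least≼-all mL (inj₁ gt)))

  record Merge (A C : List E) : Set where
    constructor mkMerge
    field
      merged    : List E
      ↭++       : merged ↭ A ++ C
      pinnacles : Pinnacle merged ≐ Pinnacle A ∪ Pinnacle C

  merge-comm : ∀ {A C} → Merge C A → Merge A C
  merge-comm {A} {C} (mkMerge X X↭ pins) =
    mkMerge X (↭-trans X↭ (++-comm C A)) (≐-trans pins (∪-comm _ _))

  merge-∷-max : ∀ {A M C} → All (_< M) A → All (_< M) C → Merge A C → Merge A (M ∷ C)
  merge-∷-max {A} {M} {C} A<M C<M (mkMerge X X↭ pins) =
    mkMerge (X ∷ʳ M) (↭-trans (↭-sym (∷↭∷ʳ M X)) (↭-trans (prep M X↭) (↭-sym (shift M A C)))) (begin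
      Pinnacle (X ∷ʳ M)             ≈⟨ pinnacle-∷ʳ-max X (All-resp-↭ (↭-sym X↭) (All.++⁺ A<M C<M)) ⟩
      Pinnacle X                    ≈⟨ pins ⟩
      Pinnacle A ∪ Pinnacle C       ≈⟨ ∪-cong ≐-refl (pinnacle-max∷ C C<M) ⟨
      Pinnacle A ∪ Pinnacle (M ∷ C) ∎)

  merge-++-max : ∀ {A C₁ M C₂} → NonEmpty C₁ → All (_< M) A → All (_< M) C₁ → All (_< M) C₂ →
                 Merge A C₁ → Merge A (C₁ ++ M ∷ C₂)
  merge-++-max {A} {C₁} {M} {C₂} neC₁ A<M C₁<M C₂<M (mkMerge X X↭ pins) =
    mkMerge (X ++ M ∷ C₂) (↭-trans (++⁺ʳ (M ∷ C₂) X↭) (↭-reflexive (++-assoc A C₁ (M ∷ C₂))))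
      (pinnacle-++-max-∪ C₂ (NonEmpty-resp-↭ (↭-sym X↭) (NonEmpty-++⁺ʳ A neC₁)) neC₁
                         (All-resp-↭ (↭-sym X↭) (All.++⁺ A<M C₁<M)) C₁<M C₂<M pins)

  -- The comparison of the two maxima is eliminated with [_,_]′, not with `with`: a with-function
  -- would rebuild tA and tC from their pieces and hide from the termination checker that the
  -- recursive calls are on subtrees.
  merge : ∀ {A C} → MaxTree A → MaxTree C → Disjoint A C → Merge A C
  merge-below : ∀ {A C₁ M C₂} → MaxTree A → All (_< M) A →
                MaxTree C₁ → All (_< M) C₁ → All (_< M) C₂ → MaxTree C₂ →
                Disjoint A (C₁ ++ M ∷ C₂) → Merge A (C₁ ++ M ∷ C₂)

  merge leaf _ _ = mkMerge _ ↭-refl (inj₂ , [ (λ ()) , id ])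
  merge (node _ _ _ _) leaf _ = mkMerge _ (↭-reflexive (sym (++-identityʳ _))) (inj₁ , [ id , (λ ()) ])
  merge tA@(node {L₁} {M₁} tL₁ l₁ r₁ tR₁) tC@(node {L₂} {M₂} tL₂ l₂ r₂ tR₂) A#C =
    [ (λ M₁<M₂ → merge-below tA (++-∷-below L₁ l₁ r₁ M₁<M₂) tL₂ l₂ r₂ tR₂ A#C) ,
    [ (λ M₁≡M₂ → ⊥-elim (A#C (max∈ L₁ , subst (_∈ _) (sym M₁≡M₂) (max∈ L₂)))) ,
      (λ M₂<M₁ → merge-comm
                   (merge-below tC (++-∷-below L₂ l₂ r₂ M₂<M₁) tL₁ l₁ r₁ tR₁ (Disjoint.sym A#C))) ]′ ]′
    (trichotomy M₁ M₂)

  merge-below tA A<M leaf _ C₂<M tC₂ A#C =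
    merge-∷-max A<M C₂<M (merge tA tC₂ (λ (a , c) → A#C (a , there c)))
  merge-below tA A<M tC₁@(node _ _ _ _) C₁<M C₂<M _ A#C =
    merge-++-max (NonEmpty-++⁺ʳ _ tt) A<M C₁<M C₂<M (merge tA tC₁ (λ (a , c) → A#C (a , ∈-++⁺ˡ c)))

  record MergeExceptOne (A C : List E) : Set where
    constructor mkMergeExceptOne
    field
      dropped   : E
      merged    : List E
      ↭++       : dropped ∷ merged ↭ A ++ C
      nonEmpty  : NonEmpty merged
      pinnacles : Pinnacle merged ≐ Pinnacle A ∪ Pinnacle C

  mergeExceptOne-comm : ∀ {A C} → MergeExceptOne C A → MergeExceptOne A C
  mergeExceptOne-comm {A} {C} (mkMergeExceptOne y X yX↭ neX pins) =
    mkMergeExceptOne y X (↭-trans yX↭ (++-comm C A)) neX (≐-trans pins (∪-comm _ _))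

  mergeExceptOne-∷-max : ∀ {A M C} → NonEmpty A → All (_< M) C → Merge A C → MergeExceptOne A (M ∷ C)
  mergeExceptOne-∷-max {A} {M} {C} neA C<M (mkMerge X X↭ pins) =
    mkMergeExceptOne M X (↭-trans (prep M X↭) (↭-sym (shift M A C)))
      (NonEmpty-resp-↭ (↭-sym X↭) (NonEmpty-++⁺ˡ C neA))
      (≐-trans pins (∪-cong ≐-refl (≐-sym (pinnacle-max∷ C C<M))))

  mergeExceptOne-++-max : ∀ {A C₁ M C₂} → NonEmpty C₁ → All (_< M) A → All (_< M) C₁ → All (_< M) C₂ →
                          MergeExceptOne A C₁ → MergeExceptOne A (C₁ ++ M ∷ C₂)
  mergeExceptOne-++-max {A} {C₁} {M} {C₂} neC₁ A<M C₁<M C₂<M (mkMergeExceptOne y X yX↭ neX pins) =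
    mkMergeExceptOne y (X ++ M ∷ C₂)
      (↭-trans (++⁺ʳ (M ∷ C₂) yX↭) (↭-reflexive (++-assoc A C₁ (M ∷ C₂))))
      (NonEmpty-++⁺ʳ X tt)
      (pinnacle-++-max-∪ C₂ neX neC₁ (All.tail (All-resp-↭ (↭-sym yX↭) (All.++⁺ A<M C₁<M)))
                         C₁<M C₂<M pins)

  mergeExceptOne : ∀ {A C} → MaxTree A → NonEmpty A → MaxTree C → NonEmpty C → Disjoint A C →
                   MergeExceptOne A C
  mergeExceptOne-below : ∀ {A C₁ M C₂} → MaxTree A → NonEmpty A → All (_< M) A →
                         MaxTree C₁ → All (_< M) C₁ → All (_< M) C₂ → MaxTree C₂ →
                         Disjoint A (C₁ ++ M ∷ C₂) → MergeExceptOne A (C₁ ++ M ∷ C₂)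

  mergeExceptOne tA@(node {L₁} {M₁} tL₁ l₁ r₁ tR₁) neA tC@(node {L₂} {M₂} tL₂ l₂ r₂ tR₂) neC A#C =
    [ (λ M₁<M₂ → mergeExceptOne-below tA neA (++-∷-below L₁ l₁ r₁ M₁<M₂) tL₂ l₂ r₂ tR₂ A#C) ,
    [ (λ M₁≡M₂ → ⊥-elim (A#C (max∈ L₁ , subst (_∈ _) (sym M₁≡M₂) (max∈ L₂)))) ,
      (λ M₂<M₁ → mergeExceptOne-comm (mergeExceptOne-below tC neC (++-∷-below L₂ l₂ r₂ M₂<M₁)
                                                            tL₁ l₁ r₁ tR₁ (Disjoint.sym A#C))) ]′ ]′
    (trichotomy M₁ M₂)

  mergeExceptOne-below tA neA A<M leaf _ C₂<M tC₂ A#C =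
    mergeExceptOne-∷-max neA C₂<M (merge tA tC₂ (λ (a , c) → A#C (a , there c)))
  mergeExceptOne-below tA neA A<M tC₁@(node _ _ _ _) C₁<M C₂<M _ A#C =
    mergeExceptOne-++-max (NonEmpty-++⁺ʳ _ tt) A<M C₁<M C₂<M
      (mergeExceptOne tA neA tC₁ (NonEmpty-++⁺ʳ _ tt) (λ (a , c) → A#C (a , ∈-++⁺ˡ c)))

module ColouredPermutations where

  open import Relation.Unary using (_≐_; _∪_)
  open import Relation.Unary.Algebra using (∪-assoc)
  open import Relation.Unary.Properties using (≐-refl; ≐-sym; ≐-trans)
  open import Relation.Unary.Relation.Binary.Equality using (≐-setoid)

  colour : ∀ {M n} → Elt M n → Fin M
  colour = proj₁

  label : ∀ {M n} → Elt M n → Fin n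
  label = proj₂

  recolour : ∀ {M n} → Fin M → Elt M n → Elt M n
  recolour d u = d , label u

  ≺-trans : ∀ {M n} → Transitive (_≺_ {M} {n})
  ≺-trans (inj₁ b<a)         (inj₁ c<b)         = inj₁ (ℕ.<-trans c<b b<a)
  ≺-trans (inj₁ b<a)         (inj₂ (b≡c , _))   = inj₁ (subst (_< _) b≡c b<a)
  ≺-trans (inj₂ (a≡b , _))   (inj₁ c<b)         = inj₁ (subst (_ <_) (sym a≡b) c<b)
  ≺-trans (inj₂ (a≡b , y<x)) (inj₂ (b≡c , z<y)) = inj₂ (trans a≡b b≡c , ℕ.<-trans z<y y<x)

  ≺-irrefl : ∀ {M n} → Irreflexive _≡_ (_≺_ {M} {n})
  ≺-irrefl refl (inj₁ a<a)       = ℕ.<-irrefl refl a<a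
  ≺-irrefl refl (inj₂ (_ , x<x)) = ℕ.<-irrefl refl x<x

  private
    tri-≺ : ∀ {M n} {u v : Elt M n} → u ≺ v → Tri (u ≺ v) (u ≡ v) (v ≺ u)
    tri-≺ u≺v = tri< u≺v (λ u≡v → ≺-irrefl u≡v u≺v) (λ v≺u → ≺-irrefl refl (≺-trans u≺v v≺u))

    tri-≻ : ∀ {M n} {u v : Elt M n} → v ≺ u → Tri (u ≺ v) (u ≡ v) (v ≺ u)
    tri-≻ v≺u =
      tri> (λ u≺v → ≺-irrefl refl (≺-trans u≺v v≺u)) (λ u≡v → ≺-irrefl (sym u≡v) v≺u) v≺u

  ≺-compare : ∀ {M n} → Trichotomous _≡_ (_≺_ {M} {n})
  ≺-compare (a , x) (b , y) with ℕ.<-cmp (toℕ b) (toℕ a) | ℕ.<-cmp (toℕ y) (toℕ x)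
  ... | tri< b<a _ _ | _            = tri-≺ (inj₁ b<a)
  ... | tri> _ _ a<b | _            = tri-≻ (inj₁ a<b)
  ... | tri≈ _ b≡a _ | tri< y<x _ _ = tri-≺ (inj₂ (sym b≡a , y<x))
  ... | tri≈ _ b≡a _ | tri> _ _ x<y = tri-≻ (inj₂ (b≡a , x<y))
  ... | tri≈ _ b≡a _ | tri≈ _ y≡x _ = tri≈ (≺-irrefl u≡v) u≡v (≺-irrefl (sym u≡v))
    where
    u≡v = cong₂ _,_ (toℕ-injective (sym b≡a)) (toℕ-injective (sym y≡x))

  ≺-isStrictTotalOrder : ∀ {M n} → IsStrictTotalOrder _≡_ (_≺_ {M} {n})
  ≺-isStrictTotalOrder = record
    { isStrictPartialOrder = record
      { isEquivalence = isEquivalence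
      ; irrefl        = ≺-irrefl
      ; trans         = ≺-trans
      ; <-resp-≈      = resp₂ _≺_
      }
    ; compare = ≺-compare
    }

  open module EltPinnacles {M n : ℕ} = Pinnacles (≺-isStrictTotalOrder {M} {n})

  ≺-by-colour : ∀ {M n} {u v : Elt M n} → toℕ (colour v) < toℕ (colour u) → u ≺ v
  ≺-by-colour = inj₁

  ≼⇒colour≥ : ∀ {M n} {u v : Elt M n} → u ≼ v → toℕ (colour v) ≤ toℕ (colour u)
  ≼⇒colour≥ (inj₁ (inj₁ v<u))       = <⇒≤ v<u
  ≼⇒colour≥ (inj₁ (inj₂ (u≡v , _))) = ≤-reflexive (sym u≡v)
  ≼⇒colour≥ (inj₂ refl)             = ≤-refl

  colsum : ∀ {M n} → List (Elt M n) → ℕ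
  colsum = sum ∘ map (toℕ ∘ colour)

  record Recolouring {m n} (p : ℕ) (ℓ : List (Elt m n)) : Set where
    constructor mkRecolouring
    field
      first     : Elt m n
      rest      : List (Elt m n)
      newColour : Fin m
      ↭ℓ        : first ∷ rest ↭ ℓ
      pinnacles : Pinnacle (recolour newColour first ∷ rest) ≐ Pinnacle ℓ
      divisible : p ∣ toℕ newColour + colsum rest

  module _ {m n p : ℕ} .{{_ : NonZero p}} (p≤m∸p : p ≤ m ∸ p) where

    open import Relation.Binary.Reasoning.Setoid (≐-setoid (Elt m n) 0ℓ)

    private
      p≤m : p ≤ m
      p≤m = ≤-trans p≤m∸p (m∸n≤m m p)

      upper-window : m ∸ p + p ≤ m
      upper-window = ≤-reflexive (m∸n+n≡m p≤m)

    recolouring-max-first : ∀ {ℓ T h t} → p ≤ toℕ (colour h) →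
                            T ∷ h ∷ t ↭ ℓ → Pinnacle ℓ ≐ Pinnacle (h ∷ t) → Recolouring p ℓ
    recolouring-max-first {ℓ} {T} {h} {t} p≤h ↭ℓ ℓ≐ht
      with ∃-colour-in-window p (colsum (h ∷ t)) 0 p≤m
    ... | d , _ , d<p , p∣ = mkRecolouring T (h ∷ t) d ↭ℓ (begin
      Pinnacle (recolour d T ∷ h ∷ t) ≈⟨ pinnacle-∷-descent t (≺-by-colour (<-≤-trans d<p p≤h)) ⟩
      Pinnacle (h ∷ t)                ≈⟨ ℓ≐ht ⟨
      Pinnacle ℓ                      ∎) p∣

    recolouring-least-first : ∀ {ℓ T h t} → toℕ (colour h) < p → All (h ≼_) t → Unique (h ∷ t) →
                              All (_≺ T) (h ∷ t) → h ∷ t ∷ʳ T ↭ ℓ → Pinnacle ℓ ≐ Pinnacle (h ∷ t) →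
                              Recolouring p ℓ
    recolouring-least-first {ℓ} {T} {h} {t} h<p h≼t (h∉t ∷ _) ht≺T ↭ℓ ℓ≐ht
      with ∃-colour-in-window p (colsum (t ∷ʳ T)) (m ∸ p) upper-window
    ... | d , m∸p≤d , _ , p∣ = mkRecolouring h (t ∷ʳ T) d ↭ℓ (begin
      Pinnacle (recolour d h ∷ t ∷ʳ T) ≈⟨ recolour-least t h≼t h∉t ⟩
      Pinnacle (h ∷ t ∷ʳ T)            ≈⟨ pinnacle-∷ʳ-max (h ∷ t) ht≺T ⟩
      Pinnacle (h ∷ t)                 ≈⟨ ℓ≐ht ⟨
      Pinnacle ℓ                       ∎) p∣
      where
      h′≺ : ∀ {b} → h ≼ b → recolour d h ≺ b
      h′≺ h≼b = ≺-by-colour (≤-<-trans (≼⇒colour≥ h≼b) (<-≤-trans h<p (≤-trans p≤m∸p m∸p≤d)))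
      recolour-least : ∀ t → All (h ≼_) t → All (h ≢_) t →
                       Pinnacle (recolour d h ∷ t ∷ʳ T) ≐ Pinnacle (h ∷ t ∷ʳ T)
      recolour-least [] _ _ = pinnacle-head-below [] (h′≺ (inj₁ (All.head ht≺T))) (All.head ht≺T)
      recolour-least (s ∷ ss) (h≼s ∷ _) (h≢s ∷ _) =
        pinnacle-head-below (ss ∷ʳ T) (h′≺ h≼s) ([ id , ⊥-elim ∘ h≢s ]′ h≼s)

    recolouring-max-at-end : ∀ {ℓ T Z} → MinFirst Z → All (_≺ T) Z → Unique ℓ →
                             T ∷ Z ↭ ℓ → Pinnacle ℓ ≐ Pinnacle Z → Recolouring p ℓ
    recolouring-max-at-end {ℓ} {T} {Z} (mkMinFirst h t ht↭Z ht≐Z h≼t) Z≺T uℓ T∷Z↭ℓ ℓ≐Z =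
      [ (λ p≤h → recolouring-max-first p≤h T∷ht↭ℓ ℓ≐ht) ,
        (λ h<p → recolouring-least-first h<p h≼t u-ht ht≺T ht∷ʳT↭ℓ ℓ≐ht) ]′
      (ℕ.≤-<-connex p (toℕ (colour h)))
      where
      ht≺T : All (_≺ T) (h ∷ t)
      ht≺T = All-resp-↭ (↭-sym ht↭Z) Z≺T
      ℓ≐ht : Pinnacle ℓ ≐ Pinnacle (h ∷ t)
      ℓ≐ht = ≐-trans ℓ≐Z (≐-sym ht≐Z)
      T∷ht↭ℓ : T ∷ h ∷ t ↭ ℓ
      T∷ht↭ℓ = ↭-trans (prep T ht↭Z) T∷Z↭ℓ
      ht∷ʳT↭ℓ : h ∷ t ∷ʳ T ↭ ℓ
      ht∷ʳT↭ℓ = ↭-trans (++⁺ʳ (T ∷ []) ht↭Z) (↭-trans (↭-sym (∷↭∷ʳ T Z)) T∷Z↭ℓ)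
      u-ht : Unique (h ∷ t)
      u-ht with Unique-resp-↭ (↭-sym T∷ht↭ℓ) uℓ
      ... | _ ∷ u = u

    recolouring-max-inside : ∀ {L T R} → MaxTree L → NonEmpty L → All (_≺ T) L →
                             All (_≺ T) R → MaxTree R → NonEmpty R →
                             Unique (L ++ T ∷ R) → toℕ (colour T) < m ∸ p → Recolouring p (L ++ T ∷ R)
    recolouring-max-inside {L} {T} {R} tL neL L≺T R≺T tR neR uLTR T<m∸p
      with mergeExceptOne tL neL tR neR (λ (l , r) → Unique-++⇒Disjoint L uLTR (l , there r))
    ... | mkMergeExceptOne y X yX↭ neX X≐ with ∃-colour-in-window p (colsum (T ∷ X)) (m ∸ p) upper-window
    ...   | d , m∸p≤d , _ , p∣ = mkRecolouring y (T ∷ X) d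
      (↭-trans (swap y T ↭-refl) (↭-trans (prep T yX↭) (↭-sym (shift T L R)))) (begin
      Pinnacle (recolour d y ∷ T ∷ X)                    ≈⟨ pinnacle-head-below X y′≺T y≺T ⟩
      Pinnacle (y ∷ T ∷ X)                               ≈⟨ pinnacle-++-max (y ∷ []) X (y≺T ∷ []) X≺T ⟩
      Pinnacle (y ∷ []) ∪ Pinnacle X ∪ Peak (y ∷ []) T X ≈⟨ drop-y ⟩
      (Pinnacle L ∪ Pinnacle R) ∪ Peak L T R             ≈⟨ ∪-assoc _ _ _ ⟩
      Pinnacle L ∪ Pinnacle R ∪ Peak L T R               ≈⟨ pinnacle-++-max L R L≺T R≺T ⟨
      Pinnacle (L ++ T ∷ R)                              ∎) p∣
      where
      yX≺T : All (_≺ T) (y ∷ X)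
      yX≺T = All-resp-↭ (↭-sym yX↭) (All.++⁺ L≺T R≺T)
      y≺T : y ≺ T
      y≺T = All.head yX≺T
      X≺T : All (_≺ T) X
      X≺T = All.tail yX≺T
      y′≺T : recolour d y ≺ T
      y′≺T = ≺-by-colour (<-≤-trans T<m∸p m∸p≤d)
      drop-y : Pinnacle (y ∷ []) ∪ Pinnacle X ∪ Peak (y ∷ []) T X ≐ (Pinnacle L ∪ Pinnacle R) ∪ Peak L T R
      drop-y = [ (λ ()) , [ inj₁ ∘ proj₁ X≐ , (λ (T≡e , _) → inj₂ (T≡e , neL , neR)) ]′ ]′ ,
               [ inj₂ ∘ inj₁ ∘ proj₂ X≐ , (λ (T≡e , _) → inj₂ (inj₂ (T≡e , tt , neX))) ]′

    recolouring : ∀ {ℓ} → Unique ℓ → 2 ≤ length ℓ → Any (λ u → toℕ (colour u) < m ∸ p) ℓ →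
                  Recolouring p ℓ
    recolouring uℓ = by-max-tree (maxTree uℓ) uℓ
      where
      by-max-tree : ∀ {ℓ} → MaxTree ℓ → Unique ℓ → 2 ≤ length ℓ → Any (λ u → toℕ (colour u) < m ∸ p) ℓ →
                    Recolouring p ℓ
      by-max-tree (node leaf _ _ leaf) _ (s≤s ()) _
      by-max-tree (node leaf _ R≺T (node t₁ l₁ r₁ t₂)) uℓ _ _ =
        recolouring-max-at-end (minFirst t₁ l₁ r₁ t₂) R≺T uℓ ↭-refl (pinnacle-max∷ _ R≺T)
      by-max-tree (node {L} {T} (node t₁ l₁ r₁ t₂) L≺T _ leaf) uℓ _ _ =
        recolouring-max-at-end (minFirst t₁ l₁ r₁ t₂) L≺T uℓ (∷↭∷ʳ T L) (pinnacle-∷ʳ-max L L≺T)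
      by-max-tree (node {L} {T} {R} tL@(node _ _ _ _) L≺T R≺T tR@(node _ _ _ _)) uℓ _ small =
        recolouring-max-inside tL (NonEmpty-++⁺ʳ _ tt) L≺T R≺T tR (NonEmpty-++⁺ʳ _ tt) uℓ
          (All.lookupWith (λ u≼T u<m∸p → ≤-<-trans (≼⇒colour≥ u≼T) u<m∸p)
                          (All.++⁺ (All.map inj₁ L≺T) (inj₂ refl ∷ All.map inj₁ R≺T)) small)

  lookup-label-injective : ∀ {M n} {ℓ : List (Elt M n)} → AllPairs (_≢_ on label) ℓ →
                           ∀ a b → label (lookup ℓ a) ≡ label (lookup ℓ b) → a ≡ b
  lookup-label-injective (_ ∷ _)    zero    zero    _  = refl
  lookup-label-injective (x∉ ∷ _)   zero    (suc b) eq = ⊥-elim (All.lookup x∉ (∈-lookup b) eq)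
  lookup-label-injective (x∉ ∷ _)   (suc a) zero    eq = ⊥-elim (All.lookup x∉ (∈-lookup a) (sym eq))
  lookup-label-injective (_ ∷ uniq) (suc a) (suc b) eq = cong suc (lookup-label-injective uniq a b eq)

  fromList : ∀ {M n} (ℓ : List (Elt M n)) → length ℓ ≡ n → Unique (map label ℓ) →
             (∀ j → j ∈ map label ℓ) → ColPerm M n
  fromList {M} {n} ℓ |ℓ|≡n uniq cover =
    record { σ = permutation (label ∘ v) g label∘v∘g g∘label∘v ; col = colour ∘ v }
    where
    v : Fin n → Elt M n
    v = lookup ℓ ∘ cast (sym |ℓ|≡n)
    position : ∀ j → Any ((j ≡_) ∘ label) ℓ
    position j = Any.map⁻ (cover j)
    g : Fin n → Fin n
    g j = cast |ℓ|≡n (Any.index (position j))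
    label∘v∘g : ∀ j → label (v (g j)) ≡ j
    label∘v∘g j = trans (cong (label ∘ lookup ℓ) (cast-involutive (sym |ℓ|≡n) |ℓ|≡n _))
                        (sym (Any.lookup-index (position j)))
    g∘label∘v : ∀ i → g (label (v i)) ≡ i
    g∘label∘v i =
      trans (cong (cast |ℓ|≡n) (lookup-label-injective (AllPairs.map⁻ uniq) _ _
                                  (sym (Any.lookup-index (position (label (v i)))))))
            (cast-involutive |ℓ|≡n (sym |ℓ|≡n) i)

  σ-injective : ∀ {M n} (w : ColPerm M n) {i j} → σ w ⟨$⟩ʳ i ≡ σ w ⟨$⟩ʳ j → i ≡ j
  σ-injective w = Injection.injective (Inverse⇒Injection (σ w))

  labels-unique : ∀ {M n} (w : ColPerm M n) → Unique (map label (tabulate (apply w)))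
  labels-unique w = AllPairs.map⁺ (AllPairs.tabulate⁺ (λ i≢j → i≢j ∘ σ-injective w))

  labels-cover : ∀ {M n} (w : ColPerm M n) j → j ∈ map label (tabulate (apply w))
  labels-cover w j = Any.map⁺ (Any.tabulate⁺ (σ w ⟨$⟩ˡ j) (sym (inverseʳ (σ w))))

  ε≡colsum : ∀ {M n} (w : ColPerm M n) → ε w ≡ colsum (tabulate (apply w))
  ε≡colsum w =
    cong sum (trans (map-tabulate id (toℕ ∘ col w)) (sym (map-tabulate (apply w) (toℕ ∘ colour))))

  recolouredPermutation : ∀ {m n p} (w : ColPerm m n) → Recolouring p (tabulate (apply w)) →
                          Σ (ColPerm m n) λ w′ → p ∣ ε w′ × Pin w ≐ Pin w′
  recolouredPermutation {m} {n} {p} w (mkRecolouring u us d ↭ℓ pins p∣) =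
    w′ , subst (p ∣_) (sym ε≡) p∣ , Pin≐
    where
    ℓ′ = recolour d u ∷ us
    labels↭ : map label ℓ′ ↭ map label (tabulate (apply w))
    labels↭ = Permutation.map⁺ label ↭ℓ
    |ℓ′|≡n = trans (↭-length ↭ℓ) (length-tabulate (apply w))
    w′ = fromList ℓ′ |ℓ′|≡n (Unique-resp-↭ (↭-sym labels↭) (labels-unique w))
                    (Permutation.∈-resp-↭ (↭-sym labels↭) ∘ labels-cover w)
    tab≡ : tabulate (apply w′) ≡ ℓ′
    tab≡ = tabulate-lookup-cast ℓ′ |ℓ′|≡n
    ε≡ : ε w′ ≡ toℕ d + colsum us
    ε≡ = trans (ε≡colsum w′) (cong colsum tab≡)
    Pin≐ : Pin w ≐ Pin w′
    Pin≐ = begin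
      Pin w                          ≈⟨ pinnacle-tabulate (apply w) ⟩
      Pinnacle (tabulate (apply w))  ≈⟨ pins ⟨
      Pinnacle ℓ′                    ≈⟨ Pinnacle-cong tab≡ ⟨
      Pinnacle (tabulate (apply w′)) ≈⟨ pinnacle-tabulate (apply w′) ⟨
      Pin w′                         ∎
      where open import Relation.Binary.Reasoning.Setoid (≐-setoid (Elt m n) 0ℓ)

  module Lifting {m p n : ℕ} (p≤m : p ≤ m) where

    ψ′ : Elt p n → Elt m n
    ψ′ = ψ m p p≤m

    lift : ColPerm p n → ColPerm m n
    lift v = record { σ = σ v ; col = colour ∘ ψ′ ∘ apply v }

    colour-ψ : ∀ u → toℕ (colour (ψ′ u)) ≡ toℕ (colour u) + (m ∸ p)
    colour-ψ _ = toℕ-fromℕ< _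

    ψ-mono : ∀ {u v} → u ≺ v → ψ′ u ≺ ψ′ v
    ψ-mono {u} {v} (inj₁ b<a) =
      inj₁ (subst₂ _<_ (sym (colour-ψ v)) (sym (colour-ψ u)) (+-monoˡ-< (m ∸ p) b<a))
    ψ-mono {u} {v} (inj₂ (a≡b , y<x)) =
      inj₂ (trans (colour-ψ u) (trans (cong (_+ (m ∸ p)) a≡b) (sym (colour-ψ v))) , y<x)

    ψ-reflect : ∀ {u v} → ψ′ u ≺ ψ′ v → u ≺ v
    ψ-reflect {u} {v} (inj₁ b<a) =
      inj₁ (+-cancelʳ-< (m ∸ p) _ _ (subst₂ _<_ (colour-ψ v) (colour-ψ u) b<a))
    ψ-reflect {u} {v} (inj₂ (a≡b , y<x)) =
      inj₂ (+-cancelʳ-≡ (m ∸ p) _ _ (trans (sym (colour-ψ u)) (trans a≡b (colour-ψ v))) , y<x)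

    Pin-lift : ∀ v → Pin (lift v) ≐ Ψ m p p≤m (Pin v)
    Pin-lift v =
      (λ (i , j , k , j≡ , k≡ , e≡ , kj , ij) →
         apply v j , (i , j , k , j≡ , k≡ , refl , ψ-reflect kj , ψ-reflect ij) , e≡) ,
      (λ (_ , (i , j , k , j≡ , k≡ , e′≡ , kj , ij) , ψe′≡e) →
         i , j , k , j≡ , k≡ , trans (cong ψ′ e′≡) ψe′≡e , ψ-mono kj , ψ-mono ij)

    ε-lift : ∀ v → ε (lift v) ≡ ε v + n * (m ∸ p)
    ε-lift v = begin
      ε (lift v)
        ≡⟨ cong sum (map-cong (colour-ψ ∘ apply v) (allFin n)) ⟩
      sum (map (λ i → toℕ (col v i) + (m ∸ p)) (allFin n))
        ≡⟨ sum-map-+ (toℕ ∘ col v) (m ∸ p) (allFin n) ⟩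
      ε v + length (allFin n) * (m ∸ p)
        ≡⟨ cong (λ l → ε v + l * (m ∸ p)) (length-tabulate {n = n} id) ⟩
      ε v + n * (m ∸ p)
        ∎
      where open ≡-Reasoning

    unlift : (w : ColPerm m n) → (∀ i → m ∸ p ≤ toℕ (col w i)) → ColPerm p n
    unlift w high = record { σ = σ w ; col = λ i → fromℕ< (lowered< i) }
      where
      lowered< : ∀ i → toℕ (col w i) ∸ (m ∸ p) < p
      lowered< i =
        subst (toℕ (col w i) ∸ (m ∸ p) <_) (m∸[m∸n]≡n p≤m) (∸-monoˡ-< (toℕ<n (col w i)) (high i))

    lift-unlift : ∀ w high i → apply (lift (unlift w high)) i ≡ apply w i
    lift-unlift w high i = cong (_, σ w ⟨$⟩ʳ i) (toℕ-injective (begin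
      toℕ (colour (ψ′ (apply (unlift w high) i))) ≡⟨ colour-ψ (apply (unlift w high) i) ⟩
      toℕ (col (unlift w high) i) + (m ∸ p)       ≡⟨ cong (_+ (m ∸ p)) (toℕ-fromℕ< _) ⟩
      toℕ (col w i) ∸ (m ∸ p) + (m ∸ p)           ≡⟨ m∸n+n≡m (high i) ⟩
      toℕ (col w i)                               ∎))
      where open ≡-Reasoning

    Ψ-cong : ∀ {P Q : Subset p n} → P ≐ Q → Ψ m p p≤m P ≐ Ψ m p p≤m Q
    Ψ-cong (P⊆Q , Q⊆P) = Prod.map₂ (Prod.map₁ P⊆Q) , Prod.map₂ (Prod.map₁ Q⊆P)

  ≐⇒⇔ : ∀ {M n} {P Q : Subset M n} → P ≐ Q → P Defs.≐ Q
  ≐⇒⇔ (P⊆Q , Q⊆P) _ = mk⇔ P⊆Q Q⊆P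

  ⇔⇒≐ : ∀ {M n} {P Q : Subset M n} → P Defs.≐ Q → P ≐ Q
  ⇔⇒≐ P⇔Q = Equivalence.to (P⇔Q _) , Equivalence.from (P⇔Q _)

  APS-resp : ∀ {M q n} {P Q : Subset M n} → P Defs.≐ Q → APS M q n Q → APS M q n P
  APS-resp P⇔Q (w , q∣ε , Q⇔Pin) = w , q∣ε , ≐⇒⇔ (≐-trans (⇔⇒≐ P⇔Q) (⇔⇒≐ Q⇔Pin))

  small-colour⇒APS : ∀ {m p n} .{{_ : NonZero p}} → p ≤ m ∸ p → 2 ≤ n → (w : ColPerm m n) →
                     (∃ λ i → toℕ (col w i) < m ∸ p) → APS m p n (Pin w)
  small-colour⇒APS p≤m∸p 2≤n w (i , small)
    with recolouredPermutation w
           (recolouring p≤m∸p (Unique.map⁻ (labels-unique w))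
              (subst (2 ≤_) (sym (length-tabulate (apply w))) 2≤n) (Any.tabulate⁺ i small))
  ... | w′ , p∣ε , Pin≐ = w′ , p∣ε , ≐⇒⇔ Pin≐

  large-colours⇒lift : ∀ {m p n} (p≤m : p ≤ m) → p ∣ m ∸ p → (w : ColPerm m n) →
                       (∀ i → m ∸ p ≤ toℕ (col w i)) → ∀ {P} → P Defs.≐ Pin w → ¬ APS m p n P →
                       Σ (Subset p n) λ P′ → APS p 1 n P′ × ¬ APS p p n P′ × (P Defs.≐ Ψ m p p≤m P′)
  large-colours⇒lift {m} {p} {n} p≤m p∣m∸p w high {P} P⇔Pin P∉ =
    Pin w′ , (w′ , 1∣ _ , ≐⇒⇔ ≐-refl) , Pin-w′∉ , ≐⇒⇔ P≐Ψ
    where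
    open Lifting p≤m
    w′ = unlift w high
    P≐Ψ : P ≐ Ψ m p p≤m (Pin w′)
    P≐Ψ = ≐-trans (⇔⇒≐ P⇔Pin) (≐-trans (IndexPinnacle-cong (sym ∘ lift-unlift w high)) (Pin-lift w′))
    Pin-w′∉ : ¬ APS p p n (Pin w′)
    Pin-w′∉ (v , p∣εv , Pin-w′⇔Pin-v) =
      P∉ (lift v , subst (p ∣_) (sym (ε-lift v)) (∣m∣n⇒∣m+n p∣εv (∣n⇒∣m*n n p∣m∸p)) ,
          ≐⇒⇔ (≐-trans P≐Ψ (≐-trans (Ψ-cong (⇔⇒≐ Pin-w′⇔Pin-v)) (≐-sym (Pin-lift v)))))

open Defs using (_≐_)
open ColouredPermutations using (APS-resp; small-colour⇒APS; large-colours⇒lift)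

mainTheorem17 : (m p r : ℕ) → .{{_ : NonZero m}} → NonZero p → NonZero r →
                (p∣m : p ∣ m) → (P : Subset m (2 * r + 1)) →
                APS m 1 (2 * r + 1) P → ¬ APS m p (2 * r + 1) P →
                Σ (Subset p (2 * r + 1)) λ P′ →
                  APS p 1 (2 * r + 1) P′ × ¬ APS p p (2 * r + 1) P′ ×
                  (P ≐ Ψ m p (∣⇒≤' m p p∣m) P′)
mainTheorem17 m p r nzp nzr p∣m P (w , _ , P≐Pin-w) P∉ with any? (λ i → toℕ (col w i) <? m ∸ p)
... | yes small@(_ , c<m∸p) =
  ⊥-elim (P∉ (APS-resp P≐Pin-w (small-colour⇒APS {{nzp}} p≤m∸p (2≤2r+1 r nzr) w small)))
  where
  p≤m∸p : p ≤ m ∸ p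
  p≤m∸p = ∣⇒≤ {{>-nonZero (≤-<-trans z≤n c<m∸p)}} (∣m∣n⇒∣m∸n (∣⇒≤' m p p∣m) p∣m ∣-refl)
... | no no-small =
  large-colours⇒lift (∣⇒≤' m p p∣m) (∣m∣n⇒∣m∸n (∣⇒≤' m p p∣m) p∣m ∣-refl) w
    (λ i → ≮⇒≥ (no-small ∘ (i ,_))) P≐Pin-w P∉
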